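{- For every even integer $n\ge 4$, the Möbius ladder $M_n$ has Frank number $2$.
   Context: For even $n\ge4$, the Möbius ladder $M_n$ is the graph on a cycle $v_1v_2\cdots v_n$ together with the edges $v_iv_{i+n/2}$ for $1\le i\le n/2$. An orientation of a graph replaces each edge $uv$ by exactly one of the arcs $(u,v)$, $(v,u)$. An oriented graph is strongly connected if for any two vertices $x,y$ there is a directed $(x,y)$-path. In an orientation $O$ of $G$, an edge $e$ is deletable if $O-e$ is strongly connected. For a $3$-edge-connected graph $G$, the Frank number $F(G)$ is the minimum $k$ such that $G$ admits $k$ orientations with the property that every edge of $G$ is deletable in at least one of them. -}

module Defs where

open import Data.Nat using (ℕ; zero; suc; _+_; _<_; _<?_; ⌊_/2⌋)
import Data.Nat.Properties
open import Data.Fin using (Fin; toℕ; fromℕ<; inject≤)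
open import Data.Sum using (_⊎_; inj₁; inj₂)
open import Data.Product using (_×_; _,_; proj₁; proj₂; Σ)
open import Data.Bool using (Bool; true; false)
open import Relation.Nullary using (¬_; yes; no)
open import Relation.Binary.PropositionalEquality using (_≡_; _≢_)

-- A finite (multi)graph given by a vertex type, an edge type and the
-- endpoints of each edge (the order of the pair is only a reference
-- direction used to describe orientations).
record Graph : Set₁ where
  field
    V    : Set
    E    : Set
    ends : E → V × V
open Graph public

-- Möbius ladder M_n on vertices Fin n (v_1..v_n of the paper are 0..n-1)

-- the natural number k as an element of Fin n when k < n; otherwise the
-- default d (never used for the Möbius ladder, all values are in range)
clamp : ∀ {n} → Fin n → ℕ → Fin n
clamp {n} d k with k <? n
... | yes p = fromℕ< p
... | no _  = d

-- cycle edges v_i v_{i+1} (indices mod n), i ∈ Fin n;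
-- rungs v_i v_{i+n/2}, i ∈ Fin (n/2)
Mobius : ℕ → Graph
Mobius n = record
  { V    = Fin n
  ; E    = Fin n ⊎ Fin ⌊ n /2⌋
  ; ends = endsM
  }
  where
  endsM : Fin n ⊎ Fin ⌊ n /2⌋ → Fin n × Fin n
  endsM (inj₁ i) = i , clamp i (nxt (toℕ i))
    where
    nxt : ℕ → ℕ
    nxt k with suc k <? n
    ... | yes _ = suc k
    ... | no _  = 0
  endsM (inj₂ i) = j , clamp j (toℕ i + ⌊ n /2⌋)
    where
    j : Fin n
    j = inject≤ i (Data.Nat.Properties.⌊n/2⌋≤n n)

-- true: edge e with ends (u , v) becomes the arc (u , v); false: (v , u)
Orientation : Graph → Set
Orientation G = E G → Bool

tailA : (G : Graph) → Orientation G → E G → V G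
tailA G O e with O e
... | true  = proj₁ (ends G e)
... | false = proj₂ (ends G e)

headA : (G : Graph) → Orientation G → E G → V G
headA G O e with O e
... | true  = proj₂ (ends G e)
... | false = proj₁ (ends G e)

data DWalk (G : Graph) (O : Orientation G) (P : E G → Set) : V G → V G → Set where
  stop : ∀ {x} → DWalk G O P x x
  step : ∀ {x y} (e : E G) → P e → tailA G O e ≡ x →
         DWalk G O P (headA G O e) y → DWalk G O P x y

StronglyConnectedOn : (G : Graph) → Orientation G → (E G → Set) → Set
StronglyConnectedOn G O P = ∀ x y → DWalk G O P x y

StronglyConnected : (G : Graph) → Orientation G → Set
StronglyConnected G O = StronglyConnectedOn G O (λ _ → ⊤)
  where open import Data.Unit using (⊤)

Deletable : (G : Graph) → Orientation G → E G → Set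
Deletable G O e = StronglyConnectedOn G O (λ f → f ≢ e)

data UWalk (G : Graph) (P : E G → Set) : V G → V G → Set where
  stop : ∀ {x} → UWalk G P x x
  fwd  : ∀ {y} (e : E G) → P e →
         UWalk G P (proj₂ (ends G e)) y → UWalk G P (proj₁ (ends G e)) y
  bwd  : ∀ {y} (e : E G) → P e →
         UWalk G P (proj₁ (ends G e)) y → UWalk G P (proj₂ (ends G e)) y

-- removing any at most two edges (e = f allowed) leaves G connected
ThreeEdgeConnected : Graph → Set
ThreeEdgeConnected G =
  ∀ (e f : E G) (x y : V G) → UWalk G (λ g → g ≢ e × g ≢ f) x y

DeletionCover : (G : Graph) → ℕ → Set
DeletionCover G k =
  Σ (Fin k → Orientation G) λ Os → ∀ (e : E G) → Σ (Fin k) λ i → Deletable G (Os i) e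

FrankNumberIs : Graph → ℕ → Set
FrankNumberIs G k =
  ThreeEdgeConnected G × DeletionCover G k × (∀ m → m < k → ¬ DeletionCover G m)

{-# OPTIONS --safe #-}
-- Vertex 0 of M_n has degree 3.  If every edge were deletable in a single orientation,
-- then after deleting any one of the three edges at 0 the other two would have to supply
-- an arc into 0 and an arc out of 0, so the three edges would point into 0 in pairwise
-- different ways, which is impossible.  For two orientations, direct the cycle
-- 0 → 1 → ⋯ → n-1 → 0 and orient the rungs j — j+h (h = n/2) alternately up and down:
-- for odd h the two alternating patterns make every edge deletable, and for even h one
-- of them is replaced by an orientation that also reverses the cycle edges 0 and h-2.
module Submission where

open import Defs
open import Data.Bool using (Bool; true; false; not; _∧_)
open import Data.Bool.Properties using (∧-zeroʳ)
open import Data.Empty using (⊥; ⊥-elim)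
open import Data.Nat
open import Data.Nat.Properties
open import Data.Nat.Divisibility using (_∣_; divides)
open import Data.Fin as Fin using (Fin; toℕ)
open import Data.Fin.Properties using (toℕ-fromℕ<; toℕ-inject≤; toℕ-injective; toℕ<n)
open import Data.Product using (_×_; _,_; proj₁; proj₂; Σ)
open import Data.Sum using (_⊎_; inj₁; inj₂; [_,_]′)
open import Data.Sum.Properties using (inj₁-injective; ≡-dec)
open import Function using (_∘_)
open import Relation.Binary.Definitions using (DecidableEquality)
open import Relation.Binary.PropositionalEquality
open import Relation.Nullary using (¬_; yes; no; does)
open import Relation.Nullary.Decidable using (dec-true; dec-false)

module _ {G : Graph} {O : Orientation G} {P : E G → Set} where

  _++_ : ∀ {x y z} → DWalk G O P x y → DWalk G O P y z → DWalk G O P x z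
  stop            ++ w = w
  step e pe t v   ++ w = step e pe t (v ++ w)

  first-arc : ∀ {x y} → DWalk G O P x y → x ≢ y → Σ (E G) λ f → P f × tailA G O f ≡ x
  first-arc stop            x≢x = ⊥-elim (x≢x refl)
  first-arc (step e pe t _) _   = e , pe , t

  last-arc-from : ∀ {y} e → P e → DWalk G O P (headA G O e) y → Σ (E G) λ f → P f × headA G O f ≡ y
  last-arc-from e pe stop            = e , pe , refl
  last-arc-from e pe (step f pf _ w) = last-arc-from f pf w

  last-arc : ∀ {x y} → DWalk G O P x y → x ≢ y → Σ (E G) λ f → P f × headA G O f ≡ y
  last-arc stop             x≢x = ⊥-elim (x≢x refl)
  last-arc (step e pe _ w)  _   = last-arc-from e pe w

module _ (G : Graph) (O : Orientation G) where

  arc-true : ∀ {e} → O e ≡ true → (tailA G O e , headA G O e) ≡ ends G e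
  arc-true {e} o with O e | o
  ... | true | _ = refl

  arc-false : ∀ {e} → O e ≡ false → (headA G O e , tailA G O e) ≡ ends G e
  arc-false {e} o with O e | o
  ... | false | _ = refl

  arc⁺ : ∀ {P : E G → Set} {x y} e → P e → O e ≡ true → ends G e ≡ (x , y) → DWalk G O P x y
  arc⁺ {P} {x} {y} e pe o eq =
    step e pe (cong proj₁ ends≡) (subst (λ z → DWalk G O P z y) (sym (cong proj₂ ends≡)) stop)
    where
    ends≡ : (tailA G O e , headA G O e) ≡ (x , y)
    ends≡ = trans (arc-true o) eq

  arc⁻ : ∀ {P : E G → Set} {x y} e → P e → O e ≡ false → ends G e ≡ (y , x) → DWalk G O P x y
  arc⁻ {P} {x} {y} e pe o eq =
    step e pe (cong proj₂ ends≡) (subst (λ z → DWalk G O P z y) (sym (cong proj₁ ends≡)) stop)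
    where
    ends≡ : (headA G O e , tailA G O e) ≡ (y , x)
    ends≡ = trans (arc-false o) eq

Incident : (G : Graph) → V G → E G → Set
Incident G x f = proj₁ (ends G f) ≡ x ⊎ proj₂ (ends G f) ≡ x

module _ {G : Graph} (O : Orientation G) {f : E G} {x : V G} where

  head-incident : headA G O f ≡ x → Incident G x f
  head-incident hd with O f
  ... | true  = inj₂ hd
  ... | false = inj₁ hd

  tail-incident : tailA G O f ≡ x → Incident G x f
  tail-incident tl with O f
  ... | true  = inj₁ tl
  ... | false = inj₂ tl

  head≡tail⇒loop : headA G O f ≡ x → tailA G O f ≡ x → proj₁ (ends G f) ≡ proj₂ (ends G f)
  head≡tail⇒loop hd tl with O f
  ... | true  = trans tl (sym hd)
  ... | false = trans hd (sym tl)

module _ {G : Graph} {P : E G → Set} where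

  _++ᵘ_ : ∀ {x y z} → UWalk G P x y → UWalk G P y z → UWalk G P x z
  stop         ++ᵘ w = w
  fwd e pe v   ++ᵘ w = fwd e pe (v ++ᵘ w)
  bwd e pe v   ++ᵘ w = bwd e pe (v ++ᵘ w)

  reverseᵘ : ∀ {x y} → UWalk G P x y → UWalk G P y x
  reverseᵘ stop         = stop
  reverseᵘ (fwd e pe w) = reverseᵘ w ++ᵘ bwd e pe stop
  reverseᵘ (bwd e pe w) = reverseᵘ w ++ᵘ fwd e pe stop

  undirected : ∀ {O x y} → DWalk G O P x y → UWalk G P x y
  undirected stop = stop
  undirected {O} {y = y} (step e pe t w) with O e
  ... | true  = subst (λ z → UWalk G P z y) t (fwd e pe (undirected w))
  ... | false = subst (λ z → UWalk G P z y) t (bwd e pe (undirected w))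

module _ {G : Graph} {O : Orientation G} (_≟_ : DecidableEquality (E G)) where

  avoid-or-reach-tail : ∀ {P : E G → Set} f {x y} → DWalk G O P x y →
                       DWalk G O (λ g → P g × g ≢ f) x y ⊎ DWalk G O (λ g → P g × g ≢ f) x (tailA G O f)
  avoid-or-reach-tail f stop = inj₁ stop
  avoid-or-reach-tail {P} f (step e pe t w) with e ≟ f
  ... | yes refl = inj₂ (subst (λ z → DWalk G O (λ g → P g × g ≢ f) z (tailA G O f)) t stop)
  ... | no e≢f with avoid-or-reach-tail f w
  ...   | inj₁ v = inj₁ (step e (pe , e≢f) t v)
  ...   | inj₂ v = inj₂ (step e (pe , e≢f) t v)

  deletable⇒connected-without : ∀ {e} → Deletable G O e → ∀ f x y → UWalk G (λ g → g ≢ e × g ≢ f) x y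
  deletable⇒connected-without {e} del f x y = to-tail x ++ᵘ reverseᵘ (to-tail y)
    where
    to-tail : ∀ z → UWalk G (λ g → g ≢ e × g ≢ f) z (tailA G O f)
    to-tail z with avoid-or-reach-tail f (del z (tailA G O f))
    ... | inj₁ w = undirected w
    ... | inj₂ w = undirected w

private
  true≢false : true ≢ false
  true≢false ()

no-three-distinct-Bools : (p q r : Bool) → p ≢ q → p ≢ r → q ≢ r → ⊥
no-three-distinct-Bools true  true  _     p≢q _   _   = p≢q refl
no-three-distinct-Bools false false _     p≢q _   _   = p≢q refl
no-three-distinct-Bools true  false true  _   p≢r _   = p≢r refl
no-three-distinct-Bools false true  false _   p≢r _   = p≢r refl
no-three-distinct-Bools true  false false _   _   q≢r = q≢r refl
no-three-distinct-Bools false true  true  _   _   q≢r = q≢r refl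

separated⇒≢ : ∀ {A : Set} (s : A → Bool) {p q f g : A} →
              f ≡ p ⊎ f ≡ q → g ≡ p ⊎ g ≡ q → s f ≡ true → s g ≡ false → s p ≢ s q
separated⇒≢ s (inj₁ refl) (inj₁ refl) t u _  = true≢false (trans (sym t) u)
separated⇒≢ s (inj₂ refl) (inj₂ refl) t u _  = true≢false (trans (sym t) u)
separated⇒≢ s (inj₁ refl) (inj₂ refl) t u eq = true≢false (trans (sym t) (trans eq u))
separated⇒≢ s (inj₂ refl) (inj₁ refl) t u eq = true≢false (trans (sym t) (trans (sym eq) u))

module _ {G : Graph} (_≟_ : DecidableEquality (V G)) {x y : V G} (x≢y : x ≢ y) {a b c : E G}
         (incident : ∀ {f} → Incident G x f → f ≡ a ⊎ f ≡ b ⊎ f ≡ c)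
         (loopless : ∀ {f} → Incident G x f → proj₁ (ends G f) ≢ proj₂ (ends G f))
         (O : Orientation G) where

  private
    into : E G → Bool
    into f = does (headA G O f ≟ x)

    arc-into : ∀ {e} → Deletable G O e →
               Σ (E G) λ f → f ≢ e × (f ≡ a ⊎ f ≡ b ⊎ f ≡ c) × into f ≡ true
    arc-into del with last-arc (del y x) (x≢y ∘ sym)
    ... | f , f≢e , hd = f , f≢e , incident (head-incident O hd) , dec-true (headA G O f ≟ x) hd

    arc-out-of : ∀ {e} → Deletable G O e →
                 Σ (E G) λ g → g ≢ e × (g ≡ a ⊎ g ≡ b ⊎ g ≡ c) × into g ≡ false
    arc-out-of del with first-arc (del x y) x≢y
    ... | g , g≢e , tl = g , g≢e , incident (tail-incident O tl) ,
                         dec-false (headA G O g ≟ x) (λ hd → loopless (tail-incident O tl) (head≡tail⇒loop O hd tl))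

    other-two≢ : ∀ {e p q} → (∀ {f} → f ≢ e → f ≡ a ⊎ f ≡ b ⊎ f ≡ c → f ≡ p ⊎ f ≡ q) →
                Deletable G O e → into p ≢ into q
    other-two≢ others del with arc-into del | arc-out-of del
    ... | f , f≢e , f∈ , f-in | g , g≢e , g∈ , g-out =
      separated⇒≢ into (others f≢e f∈) (others g≢e g∈) f-in g-out

  degree-three⇒¬all-deletable : ¬ (∀ e → Deletable G O e)
  degree-three⇒¬all-deletable del =
    no-three-distinct-Bools (into a) (into b) (into c)
      (other-two≢ (λ { _ (inj₁ f≡a) → inj₁ f≡a ; _ (inj₂ (inj₁ f≡b)) → inj₂ f≡b
                    ; f≢c (inj₂ (inj₂ refl)) → ⊥-elim (f≢c refl) }) (del c))
      (other-two≢ (λ { _ (inj₁ f≡a) → inj₁ f≡a ; f≢b (inj₂ (inj₁ refl)) → ⊥-elim (f≢b refl)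
                    ; _ (inj₂ (inj₂ f≡c)) → inj₂ f≡c }) (del b))
      (other-two≢ (λ { f≢a (inj₁ refl) → ⊥-elim (f≢a refl) ; _ (inj₂ f∈) → f∈ }) (del a))

frank-number≡2 : ∀ {G} → DecidableEquality (E G) → E G →
                (∀ O → ¬ (∀ e → Deletable G O e)) → DeletionCover G 2 → FrankNumberIs G 2
frank-number≡2 {G} _≟_ e₀ no-single (Os , cover) = three-edge-connected , (Os , cover) , fewer
  where
  three-edge-connected : ThreeEdgeConnected G
  three-edge-connected e f with cover e
  ... | _ , del = deletable⇒connected-without _≟_ del f

  fewer : ∀ m → m < 2 → ¬ DeletionCover G m
  fewer 0 _ (_ , cover₀) with cover₀ e₀
  ... | () , _
  fewer 1 _ (Os₁ , cover₁) = no-single (Os₁ Fin.zero) λ e → only-orientation (cover₁ e)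
    where
    only-orientation : ∀ {e} → Σ (Fin 1) (λ i → Deletable G (Os₁ i) e) → Deletable G (Os₁ Fin.zero) e
    only-orientation (Fin.zero , del) = del
  fewer (suc (suc _)) (s≤s (s≤s ()))

alternating : Bool → ℕ → Bool
alternating b zero    = b
alternating b (suc j) = not (alternating b j)

alternating-not : ∀ b j → alternating (not b) j ≡ not (alternating b j)
alternating-not b zero    = refl
alternating-not b (suc j) = cong not (alternating-not b j)

alternating-flip : ∀ j {b} → alternating true j ≡ b → alternating false j ≡ not b
alternating-flip j eq = trans (alternating-not true j) (cong not eq)

cover-by-two : ∀ {G} (O₁ O₂ : Orientation G) →
               (∀ e → Deletable G O₁ e ⊎ Deletable G O₂ e) → DeletionCover G 2
cover-by-two {G} O₁ O₂ either = orientations , λ e → [ (Fin.zero ,_) , (Fin.suc Fin.zero ,_) ]′ (either e)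
  where
  orientations : Fin 2 → Orientation G
  orientations Fin.zero    = O₁
  orientations (Fin.suc _) = O₂

clamp-toℕ : ∀ {N} (d : Fin N) {a} → a < N → toℕ (clamp d a) ≡ a
clamp-toℕ {N} d {a} a<N with a <? N
... | yes p = toℕ-fromℕ< p
... | no a≮N = ⊥-elim (a≮N a<N)

-- Vertices and edges are addressed by natural numbers: vertex a, the cycle edge
-- a — a+1 (with n-1 — 0 for a = n-1) and the rung j — j+h for j < h = n/2.
-- Writing n = 4 + k and m = ⌊ k /2⌋ makes h = 2 + m hold definitionally.
module Ladder (k : ℕ) (h+h≡n : ⌊ 4 + k /2⌋ + ⌊ 4 + k /2⌋ ≡ 4 + k) where

  n h m last : ℕ
  n    = 4 + k
  h    = ⌊ n /2⌋
  m    = ⌊ k /2⌋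
  last = 3 + k

  M : Graph
  M = Mobius n

  <h⇒+h<n : ∀ {j} → j < h → j + h < n
  <h⇒+h<n {j} j<h = subst (j + h <_) h+h≡n (+-monoˡ-< h j<h)

  h<n : h < n
  h<n = <h⇒+h<n {0} z<s

  <h⇒<n : ∀ {j} → j < h → j < n
  <h⇒<n j<h = <-trans j<h h<n

  <n⇒≤last : ∀ {a} → a < n → a ≤ last
  <n⇒≤last = s≤s⁻¹

  1+m+h≡last : suc m + h ≡ last
  1+m+h≡last = suc-injective h+h≡n

  1<h : 1 < h
  1<h = s≤s (s≤s z≤n)

  m<h : m < h
  m<h = s≤s (n≤1+n m)

  1+m<h : suc m < h
  1+m<h = ≤-refl

  h≤last : h ≤ last
  h≤last = <n⇒≤last h<n

  1+m<last : suc m < last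
  1+m<last = <-≤-trans 1+m<h h≤last

  m<last : m < last
  m<last = <-trans (n<1+n m) 1+m<last

  vtx : ℕ → Fin n
  vtx = clamp Fin.zero

  toℕ-vtx : ∀ {a} → a < n → toℕ (vtx a) ≡ a
  toℕ-vtx = clamp-toℕ Fin.zero

  vtx-toℕ : (x : Fin n) → vtx (toℕ x) ≡ x
  vtx-toℕ x = toℕ-injective (toℕ-vtx (toℕ<n x))

  clamp≡vtx : ∀ {d a} → a < n → clamp d a ≡ vtx a
  clamp≡vtx {d} a<n = toℕ-injective (trans (clamp-toℕ d a<n) (sym (toℕ-vtx a<n)))

  vtx-injective : ∀ {a b} → a < n → b < n → vtx a ≡ vtx b → a ≡ b
  vtx-injective {a} {b} a<n b<n eq = trans (sym (toℕ-vtx a<n)) (trans (cong toℕ eq) (toℕ-vtx b<n))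

  cyc rung : ℕ → E M
  cyc a  = inj₁ (vtx a)
  rung j = inj₂ (clamp Fin.zero j)

  toℕ-next : (i : Fin n) → suc (toℕ i) < n → toℕ (proj₂ (ends M (inj₁ i))) ≡ suc (toℕ i)
  toℕ-next i 1+i<n with suc (toℕ i) <? n
  ... | yes p    = clamp-toℕ i p
  ... | no 1+i≮n = ⊥-elim (1+i≮n 1+i<n)

  toℕ-next-wrap : (i : Fin n) → suc (toℕ i) ≡ n → toℕ (proj₂ (ends M (inj₁ i))) ≡ 0
  toℕ-next-wrap i 1+i≡n with suc (toℕ i) <? n
  ... | yes p = ⊥-elim (<-irrefl 1+i≡n p)
  ... | no _  = clamp-toℕ i z<s

  ends-rungᶠ : (j : Fin h) → ends M (inj₂ j) ≡ (vtx (toℕ j) , vtx (toℕ j + h))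
  ends-rungᶠ j = cong₂ _,_ (toℕ-injective (trans (toℕ-inject≤ j _) (sym (toℕ-vtx (<h⇒<n (toℕ<n j))))))
                           (clamp≡vtx (<h⇒+h<n (toℕ<n j)))

  ends-cyc : ∀ {a} → suc a < n → ends M (cyc a) ≡ (vtx a , vtx (suc a))
  ends-cyc {a} 1+a<n = cong (vtx a ,_) (toℕ-injective (begin
    toℕ (proj₂ (ends M (cyc a)))  ≡⟨ toℕ-next (vtx a) (subst (λ t → suc t < n) (sym toℕ-a) 1+a<n) ⟩
    suc (toℕ (vtx a))             ≡⟨ cong suc toℕ-a ⟩
    suc a                         ≡⟨ toℕ-vtx 1+a<n ⟨
    toℕ (vtx (suc a))             ∎))
    where
    open ≡-Reasoning
    toℕ-a : toℕ (vtx a) ≡ a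
    toℕ-a = toℕ-vtx (<⇒≤ 1+a<n)

  ends-wrap : ends M (cyc last) ≡ (vtx last , vtx 0)
  ends-wrap = cong (vtx last ,_) (toℕ-injective (trans (toℕ-next-wrap (vtx last) (cong suc (toℕ-vtx ≤-refl)))
                                                      (sym (toℕ-vtx z<s))))

  ends-rung : ∀ {j} → j < h → ends M (rung j) ≡ (vtx j , vtx (j + h))
  ends-rung {j} j<h = trans (ends-rungᶠ (clamp Fin.zero j))
                            (cong (λ t → vtx t , vtx (t + h)) (clamp-toℕ Fin.zero j<h))

  edge-view : ∀ f → (Σ ℕ λ a → a < n × f ≡ cyc a) ⊎ (Σ ℕ λ j → j < h × f ≡ rung j)
  edge-view (inj₁ i) = inj₁ (toℕ i , toℕ<n i , cong inj₁ (sym (vtx-toℕ i)))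
  edge-view (inj₂ j) =
    inj₂ (toℕ j , toℕ<n j , cong inj₂ (toℕ-injective (sym (clamp-toℕ Fin.zero (toℕ<n j)))))

  endpoint-0 : ∀ f {a b} → ends M f ≡ (vtx a , vtx b) → a < n → b < n →
               Incident M (vtx 0) f → a ≡ 0 ⊎ b ≡ 0
  endpoint-0 _ eq a<n _   (inj₁ p) = inj₁ (vtx-injective a<n z<s (trans (sym (cong proj₁ eq)) p))
  endpoint-0 _ eq _   b<n (inj₂ p) = inj₂ (vtx-injective b<n z<s (trans (sym (cong proj₂ eq)) p))

  incident-0 : ∀ {f} → Incident M (vtx 0) f → f ≡ cyc 0 ⊎ f ≡ cyc last ⊎ f ≡ rung 0
  incident-0 {f} inc with edge-view f
  ... | inj₂ (j , j<h , refl) with endpoint-0 (rung j) (ends-rung j<h) (<h⇒<n j<h) (<h⇒+h<n j<h) inc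
  ...   | inj₁ refl = inj₂ (inj₂ refl)
  ...   | inj₂ j+h≡0 = ⊥-elim (m+1+n≢0 j j+h≡0)
  incident-0 {f} inc | inj₁ (a , a<n , refl) with m≤n⇒m<n∨m≡n a<n
  ... | inj₂ refl with endpoint-0 (cyc last) ends-wrap ≤-refl z<s inc
  ...   | inj₂ _ = inj₂ (inj₁ refl)
  incident-0 {f} inc | inj₁ (a , a<n , refl) | inj₁ 1+a<n with endpoint-0 (cyc a) (ends-cyc 1+a<n) a<n 1+a<n inc
  ...   | inj₁ refl = inj₁ refl

  ends-distinct : ∀ f {a b} → ends M f ≡ (vtx a , vtx b) → a < n → b < n → a ≢ b →
                  proj₁ (ends M f) ≢ proj₂ (ends M f)
  ends-distinct _ eq a<n b<n a≢b p =
    a≢b (vtx-injective a<n b<n (trans (sym (cong proj₁ eq)) (trans p (cong proj₂ eq))))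

  loopless-0 : ∀ {f} → Incident M (vtx 0) f → proj₁ (ends M f) ≢ proj₂ (ends M f)
  loopless-0 {f} inc with incident-0 {f} inc
  ... | inj₁ refl              = ends-distinct (cyc 0) (ends-cyc (<h⇒<n 1<h)) z<s (<h⇒<n 1<h) (λ ())
  ... | inj₂ (inj₁ refl)       = ends-distinct (cyc last) ends-wrap ≤-refl z<s (λ ())
  ... | inj₂ (inj₂ refl)       = ends-distinct (rung 0) (ends-rung z<s) z<s h<n (λ ())

  one-orientation-insufficient : ∀ O → ¬ (∀ e → Deletable M O e)
  one-orientation-insufficient =
    degree-three⇒¬all-deletable {G = M} Fin._≟_ 0≢1 incident-0 (λ {f} → loopless-0 {f})
    where
    0≢1 : vtx 0 ≢ vtx 1
    0≢1 eq with vtx-injective z<s (<h⇒<n 1<h) eq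
    ... | ()

  orient : (ℕ → Bool) → (ℕ → Bool) → Orientation M
  orient c r (inj₁ i) = c (toℕ i)
  orient c r (inj₂ j) = r (toℕ j)

  record Path (O : Orientation M) (P : E M → Set) (a b : ℕ) : Set where
    constructor path
    field walk : DWalk M O P (vtx a) (vtx b)

  module Paths (c r : ℕ → Bool) {P : E M → Set} where

    infixr 5 _⊙_
    _⊙_ : ∀ {a b d} → Path (orient c r) P a b → Path (orient c r) P b d → Path (orient c r) P a d
    path v ⊙ path w = path (v ++ w)

    ≡⇒path : ∀ {a b} → a ≡ b → Path (orient c r) P a b
    ≡⇒path refl = path stop

    orient-cyc : ∀ {a} → a < n → orient c r (cyc a) ≡ c a
    orient-cyc a<n = cong c (toℕ-vtx a<n)

    orient-rung : ∀ {j} → j < h → orient c r (rung j) ≡ r j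
    orient-rung j<h = cong r (clamp-toℕ Fin.zero j<h)

    cyc-arc : ∀ a → suc a < n → c a ≡ true → P (cyc a) → Path (orient c r) P a (suc a)
    cyc-arc a 1+a<n ca pe =
      path (arc⁺ M (orient c r) (cyc a) pe (trans (orient-cyc (<⇒≤ 1+a<n)) ca) (ends-cyc 1+a<n))

    cyc-arc⁻ : ∀ a → suc a < n → c a ≡ false → P (cyc a) → Path (orient c r) P (suc a) a
    cyc-arc⁻ a 1+a<n ca pe =
      path (arc⁻ M (orient c r) (cyc a) pe (trans (orient-cyc (<⇒≤ 1+a<n)) ca) (ends-cyc 1+a<n))

    wrap-arc : c last ≡ true → P (cyc last) → Path (orient c r) P last 0
    wrap-arc cl pe = path (arc⁺ M (orient c r) (cyc last) pe (trans (orient-cyc ≤-refl) cl) ends-wrap)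

    rung-arc : ∀ j → j < h → r j ≡ true → P (rung j) → Path (orient c r) P j (j + h)
    rung-arc j j<h rj pe = path (arc⁺ M (orient c r) (rung j) pe (trans (orient-rung j<h) rj) (ends-rung j<h))

    rung-arc⁻ : ∀ j → j < h → r j ≡ false → P (rung j) → Path (orient c r) P (j + h) j
    rung-arc⁻ j j<h rj pe = path (arc⁻ M (orient c r) (rung j) pe (trans (orient-rung j<h) rj) (ends-rung j<h))

    run : ∀ a b → a ≤ b → b < n → (∀ j → a ≤ j → j < b → c j ≡ true × P (cyc j)) →
          Path (orient c r) P a b
    run a zero    a≤0   _     _   = ≡⇒path (n≤0⇒n≡0 a≤0)
    run a (suc b) a≤1+b 1+b<n arcs with m≤n⇒m<n∨m≡n a≤1+b
    ... | inj₂ refl  = path stop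
    ... | inj₁ a<1+b = run a b a≤b (<⇒≤ 1+b<n) (λ j a≤j j<b → arcs j a≤j (m<n⇒m<1+n j<b))
                       ⊙ cyc-arc b 1+b<n (proj₁ (arcs b a≤b ≤-refl)) (proj₂ (arcs b a≤b ≤-refl))
      where
      a≤b : a ≤ b
      a≤b = s≤s⁻¹ a<1+b

    rooted : ∀ ρ → (∀ a → a < n → Path (orient c r) P a ρ) → (∀ b → b < n → Path (orient c r) P ρ b) →
             StronglyConnectedOn M (orient c r) P
    rooted ρ to from x y = subst₂ (DWalk M (orient c r) P) (vtx-toℕ x) (vtx-toℕ y)
                             (Path.walk (to (toℕ x) (toℕ<n x) ⊙ from (toℕ y) (toℕ<n y)))

  outside⇒≢ : ∀ {a b d j} → d < a ⊎ b ≤ d → a ≤ j → j < b → j ≢ d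
  outside⇒≢ (inj₁ d<a) a≤j _   = >⇒≢ (<-≤-trans d<a a≤j)
  outside⇒≢ (inj₂ b≤d) _   j<b = <⇒≢ (<-≤-trans j<b b≤d)

  cyc-≢ : ∀ {j d} → j < n → d < n → j ≢ d → cyc j ≢ cyc d
  cyc-≢ j<n d<n j≢d eq = j≢d (vtx-injective j<n d<n (inj₁-injective eq))

  -- Deleting the cycle edge d leaves the directed path d+1 → ⋯ → d round the cycle, so a
  -- detour from d to d+1 suffices; each detour below uses two consecutive rungs.
  module CycleForward (r : ℕ → Bool) where

    O : Orientation M
    O = orient (λ _ → true) r

    open Paths (λ _ → true) r

    rung-deletable : (j : Fin h) → Deletable M O (inj₂ j)
    rung-deletable j = rooted 0
      (λ a a<n → run a last (<n⇒≤last a<n) ≤-refl (λ _ _ _ → refl , λ ()) ⊙ wrap-arc refl (λ ()))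
      (λ b b<n → run 0 b z≤n b<n (λ _ _ _ → refl , λ ()))

    module _ {d} (d<n : d < n) where
      run-avoiding : ∀ {a b} → a ≤ b → b < n → d < a ⊎ b ≤ d → Path O (_≢ cyc d) a b
      run-avoiding {a} {b} a≤b b<n out =
        run a b a≤b b<n (λ j a≤j j<b → refl , cyc-≢ (<-trans j<b b<n) d<n (outside⇒≢ out a≤j j<b))

      to-d : ∀ a → a < n → Path O (_≢ cyc d) a d
      to-d a a<n with a ≤? d
      ... | yes a≤d = run-avoiding a≤d d<n (inj₂ ≤-refl)
      ... | no a≰d  = run-avoiding (<n⇒≤last a<n) ≤-refl (inj₁ (≰⇒> a≰d))
                      ⊙ wrap-arc refl (cyc-≢ ≤-refl d<n (>⇒≢ (<-≤-trans (≰⇒> a≰d) (<n⇒≤last a<n))))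
                      ⊙ run-avoiding z≤n d<n (inj₂ ≤-refl)

      detour⇒deletable : suc d < n → Path O (_≢ cyc d) d (suc d) → Deletable M O (cyc d)
      detour⇒deletable 1+d<n detour = rooted (suc d) (λ a a<n → to-d a a<n ⊙ detour) from-next
        where
        from-next : ∀ b → b < n → Path O (_≢ cyc d) (suc d) b
        from-next b b<n with suc d ≤? b
        ... | yes d<b = run-avoiding d<b b<n (inj₁ ≤-refl)
        ... | no d≮b  = run-avoiding (<n⇒≤last 1+d<n) ≤-refl (inj₁ ≤-refl)
                        ⊙ wrap-arc refl (cyc-≢ ≤-refl d<n (>⇒≢ (<-≤-trans ≤-refl (<n⇒≤last 1+d<n))))
                        ⊙ run-avoiding z≤n b<n (inj₂ (s≤s⁻¹ (≰⇒> d≮b)))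

    last-detour⇒deletable : Path O (_≢ cyc last) last 0 → Deletable M O (cyc last)
    last-detour⇒deletable detour = rooted 0 (λ a a<n → to-d ≤-refl a a<n ⊙ detour)
                                            (λ b b<n → run-avoiding ≤-refl z≤n b<n (inj₂ (<n⇒≤last b<n)))

    low-deletable : ∀ d → suc d < h → r d ≡ true → r (suc d) ≡ false → Deletable M O (cyc d)
    low-deletable d 1+d<h up down = detour⇒deletable (<h⇒<n d<h) (<h⇒<n 1+d<h)
      (rung-arc d d<h up (λ ())
       ⊙ cyc-arc (d + h) (<h⇒+h<n 1+d<h) refl (cyc-≢ (<h⇒+h<n d<h) (<h⇒<n d<h) (m+1+n≢m d))
       ⊙ rung-arc⁻ (suc d) 1+d<h down (λ ()))
      where
      d<h : d < h
      d<h = <⇒≤ 1+d<h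

    middle-deletable : r (suc m) ≡ true → r 0 ≡ true → Deletable M O (cyc (suc m))
    middle-deletable up up₀ = detour⇒deletable (<h⇒<n 1+m<h) h<n
      (rung-arc (suc m) 1+m<h up (λ ())
       ⊙ ≡⇒path 1+m+h≡last
       ⊙ wrap-arc refl (cyc-≢ ≤-refl (<h⇒<n 1+m<h) (>⇒≢ 1+m<last))
       ⊙ rung-arc 0 z<s up₀ (λ ()))

    high-deletable : ∀ j → suc j < h → r j ≡ false → r (suc j) ≡ true → Deletable M O (cyc (j + h))
    high-deletable j 1+j<h down up = detour⇒deletable (<h⇒+h<n j<h) (<h⇒+h<n 1+j<h)
      (rung-arc⁻ j j<h down (λ ())
       ⊙ cyc-arc j (<h⇒<n 1+j<h) refl (cyc-≢ (<h⇒<n j<h) (<h⇒+h<n j<h) (≢-sym (m+1+n≢m j)))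
       ⊙ rung-arc (suc j) 1+j<h up (λ ()))
      where
      j<h : j < h
      j<h = <⇒≤ 1+j<h

    last-deletable : r (suc m) ≡ false → r 0 ≡ false → Deletable M O (cyc last)
    last-deletable down down₀ = last-detour⇒deletable
      (≡⇒path (sym 1+m+h≡last)
       ⊙ rung-arc⁻ (suc m) 1+m<h down (λ ())
       ⊙ cyc-arc (suc m) h<n refl (cyc-≢ (<h⇒<n 1+m<h) ≤-refl (<⇒≢ 1+m<last))
       ⊙ rung-arc⁻ 0 z<s down₀ (λ ()))

  below-h : ∀ {j} → j < h → suc j < h ⊎ j ≡ suc m
  below-h j<h with m≤n⇒m<n∨m≡n j<h
  ... | inj₁ 1+j<h = inj₁ 1+j<h
  ... | inj₂ 1+j≡h = inj₂ (suc-injective 1+j≡h)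

  data CycPosition (d : ℕ) : Set where
    low    : suc d < h → CycPosition d
    middle : d ≡ suc m → CycPosition d
    high   : ∀ j → suc j < h → d ≡ j + h → CycPosition d
    wrap   : d ≡ last → CycPosition d

  cyc-position : ∀ d → d < n → CycPosition d
  cyc-position d d<n with d <? h
  ... | yes d<h = [ low , middle ]′ (below-h d<h)
  ... | no d≮h with below-h (m<n+o⇒m∸n<o d h (subst (d <_) (sym h+h≡n) d<n))
  ...   | inj₁ 1+j<h = high (d ∸ h) 1+j<h (sym (m∸n+n≡m (≮⇒≥ d≮h)))
  ...   | inj₂ j≡1+m = wrap (trans (sym (m∸n+n≡m (≮⇒≥ d≮h))) (trans (cong (_+ h) j≡1+m) 1+m+h≡last))

  cycles-suffice : ∀ {O₁ O₂} → (∀ (j : Fin h) → Deletable M O₁ (inj₂ j)) →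
                   (∀ a → a < n → Deletable M O₁ (cyc a) ⊎ Deletable M O₂ (cyc a)) →
                   ∀ e → Deletable M O₁ e ⊎ Deletable M O₂ e
  cycles-suffice {O₁} {O₂} _ cycs (inj₁ i) =
    subst (λ x → Deletable M O₁ (inj₁ x) ⊎ Deletable M O₂ (inj₁ x)) (vtx-toℕ i) (cycs (toℕ i) (toℕ<n i))
  cycles-suffice rungs _ (inj₂ j) = inj₁ (rungs j)

  module OddHalf (m-odd : alternating true m ≡ false) where
    module A = CycleForward (alternating true)
    module B = CycleForward (alternating false)

    cyc-deletable : ∀ d → d < n → Deletable M A.O (cyc d) ⊎ Deletable M B.O (cyc d)
    cyc-deletable d d<n with cyc-position d d<n
    ... | low 1+d<h with alternating true d in eq
    ...   | true  = inj₁ (A.low-deletable d 1+d<h eq (cong not eq))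
    ...   | false = inj₂ (B.low-deletable d 1+d<h (alternating-flip d eq) (cong not (alternating-flip d eq)))
    cyc-deletable d d<n | middle refl = inj₁ (A.middle-deletable (cong not m-odd) refl)
    cyc-deletable d d<n | high j 1+j<h refl with alternating true j in eq
    ...   | false = inj₁ (A.high-deletable j 1+j<h eq (cong not eq))
    ...   | true  = inj₂ (B.high-deletable j 1+j<h (alternating-flip j eq) (cong not (alternating-flip j eq)))
    cyc-deletable d d<n | wrap refl = inj₂ (B.last-deletable (cong not (alternating-flip m m-odd)) refl)

    cover : DeletionCover M 2
    cover = cover-by-two A.O B.O (cycles-suffice A.rung-deletable cyc-deletable)

  data Region : ℕ → Set where
    origin : Region 0
    lower  : ∀ {a} → 1 ≤ a → a ≤ m → Region a
    centre : Region (suc m)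
    upper  : ∀ {a} → h ≤ a → Region a

  region : ∀ a → Region a
  region zero = origin
  region (suc a) with suc a ≤? m
  ... | yes a<m = lower (s≤s z≤n) a<m
  ... | no a≮m with m≤n⇒m<n∨m≡n (≰⇒> a≮m)
  ...   | inj₁ 1+m<1+a = upper 1+m<1+a
  ...   | inj₂ 1+m≡1+a = subst Region 1+m≡1+a centre

  -- With the whole cycle directed forward, the cycle edge d is deletable only if the rungs
  -- at d and d+1 point away from d and into d+1.  For even h no two rung patterns provide
  -- this at every d, so the second orientation reverses the cycle edges 0 and m = h - 2.
  twisted : ℕ → Bool
  twisted j = not (does (j ≟ 0)) ∧ not (does (j ≟ m))

  twisted-forward : ∀ {j} → j ≢ 0 → j ≢ m → twisted j ≡ true
  twisted-forward {j} j≢0 j≢m =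
    cong₂ (λ x y → not x ∧ not y) (dec-false (j ≟ 0) j≢0) (dec-false (j ≟ m) j≢m)

  twisted-m : twisted m ≡ false
  twisted-m = trans (cong (λ x → not (does (m ≟ 0)) ∧ not x) (dec-true (m ≟ m) refl)) (∧-zeroʳ _)

  module Twisted (m-even : alternating true m ≡ true) where

    O : Orientation M
    O = orient twisted (alternating true)

    open Paths twisted (alternating true)

    module _ {d} (d<n : d < n) where

      low-run : ∀ {a b} → 1 ≤ a → a ≤ b → b ≤ m → d < a ⊎ b ≤ d → Path O (_≢ cyc d) a b
      low-run {a} {b} 1≤a a≤b b≤m out = run a b a≤b (≤-<-trans b≤m (<h⇒<n m<h)) λ j a≤j j<b →
        twisted-forward (n>0⇒n≢0 (≤-trans 1≤a a≤j)) (<⇒≢ (<-≤-trans j<b b≤m)) ,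
        cyc-≢ (<-trans (<-≤-trans j<b b≤m) (<h⇒<n m<h)) d<n (outside⇒≢ out a≤j j<b)

      upper-run : ∀ {a b} → m < a → a ≤ b → b < n → d < a ⊎ b ≤ d → Path O (_≢ cyc d) a b
      upper-run {a} {b} m<a a≤b b<n out = run a b a≤b b<n λ j a≤j j<b →
        twisted-forward (n>0⇒n≢0 (<-≤-trans (≤-<-trans z≤n m<a) a≤j)) (>⇒≢ (<-≤-trans m<a a≤j)) ,
        cyc-≢ (<-trans j<b b<n) d<n (outside⇒≢ out a≤j j<b)

      last-to-0 : last ≢ d → Path O (_≢ cyc d) last 0
      last-to-0 last≢d = wrap-arc (twisted-forward (λ ()) (>⇒≢ m<last)) (cyc-≢ ≤-refl d<n last≢d)

      0-to-h : Path O (_≢ cyc d) 0 h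
      0-to-h = rung-arc 0 z<s refl (λ ())

      via-upper-to-0 : ∀ j → j < h → alternating true j ≡ true → d < j + h → Path O (_≢ cyc d) j 0
      via-upper-to-0 j j<h up d<j+h =
        rung-arc j j<h up (λ ())
        ⊙ upper-run (<-≤-trans m<h (m≤n+m h j)) (<n⇒≤last (<h⇒+h<n j<h)) ≤-refl (inj₁ d<j+h)
        ⊙ last-to-0 (>⇒≢ (<-≤-trans d<j+h (<n⇒≤last (<h⇒+h<n j<h))))

      h-to-1 : h ≢ d → Path O (_≢ cyc d) h 1
      h-to-1 h≢d = cyc-arc h (<h⇒+h<n 1<h) (twisted-forward (λ ()) (>⇒≢ m<h)) (cyc-≢ h<n d<n h≢d)
                   ⊙ rung-arc⁻ 1 1<h refl (λ ())

      last-to-centre : Path O (_≢ cyc d) last (suc m)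
      last-to-centre = ≡⇒path (sym 1+m+h≡last) ⊙ rung-arc⁻ (suc m) 1+m<h (cong not m-even) (λ ())

      lower-to-0 : ∀ {a} → 1 ≤ a → a ≤ m → d < a ⊎ m ≤ d → d < m + h → Path O (_≢ cyc d) a 0
      lower-to-0 1≤a a≤m out d<m+h = low-run 1≤a a≤m ≤-refl out ⊙ via-upper-to-0 m m<h m-even d<m+h

      upper-to-0 : ∀ {a} → m < a → a < n → d < a → Path O (_≢ cyc d) a 0
      upper-to-0 m<a a<n d<a = upper-run m<a (<n⇒≤last a<n) ≤-refl (inj₁ d<a)
                               ⊙ last-to-0 (>⇒≢ (<-≤-trans d<a (<n⇒≤last a<n)))

      0-to-lower : ∀ {b} → h ≢ d → 1 ≤ b → b ≤ m → b ≤ d → Path O (_≢ cyc d) 0 b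
      0-to-lower h≢d 1≤b b≤m b≤d = 0-to-h ⊙ h-to-1 h≢d ⊙ low-run ≤-refl 1≤b b≤m (inj₂ b≤d)

      0-to-upper : ∀ {b} → h ≤ b → b < n → d < h ⊎ b ≤ d → Path O (_≢ cyc d) 0 b
      0-to-upper h≤b b<n out = 0-to-h ⊙ upper-run m<h h≤b b<n out

    low-deletable : ∀ d → suc d < h → alternating true d ≡ true → Deletable M O (cyc d)
    low-deletable d 1+d<h up = rooted 0 to-root from-root
      where
      d<h : d < h
      d<h = <⇒≤ 1+d<h
      d<n : d < n
      d<n = <h⇒<n d<h
      d≤m : d ≤ m
      d≤m = s≤s⁻¹ (s≤s⁻¹ 1+d<h)

      to-root : ∀ a → a < n → Path O (_≢ cyc d) a 0
      to-root a a<n with region a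
      ... | origin = path stop
      ... | centre = upper-to-0 d<n (n<1+n m) a<n (s≤s d≤m)
      ... | upper h≤a = upper-to-0 d<n (<-≤-trans m<h h≤a) a<n (<-≤-trans d<h h≤a)
      ... | lower 1≤a a≤m with a ≤? d
      ...   | yes a≤d = low-run d<n 1≤a a≤d d≤m (inj₂ ≤-refl) ⊙ via-upper-to-0 d<n d d<h up (m<m+n d z<s)
      ...   | no a≰d  = lower-to-0 d<n 1≤a a≤m (inj₁ (≰⇒> a≰d)) (≤-<-trans d≤m (m<m+n m z<s))

      from-root : ∀ b → b < n → Path O (_≢ cyc d) 0 b
      from-root b b<n with region b
      ... | origin = path stop
      ... | centre = 0-to-upper d<n h≤last ≤-refl (inj₁ d<h) ⊙ last-to-centre d<n
      ... | upper h≤b = 0-to-upper d<n h≤b b<n (inj₁ d<h)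
      ... | lower 1≤b b≤m with b ≤? d
      ...   | yes b≤d = 0-to-lower d<n (>⇒≢ d<h) 1≤b b≤m b≤d
      ...   | no b≰d  = 0-to-upper d<n (m≤n+m h (suc d)) (<h⇒+h<n 1+d<h) (inj₁ d<h)
                        ⊙ rung-arc⁻ (suc d) 1+d<h (cong not up) (λ ())
                        ⊙ low-run d<n (s≤s z≤n) (≰⇒> b≰d) b≤m (inj₁ ≤-refl)

    middle-deletable : Deletable M O (cyc (suc m))
    middle-deletable = rooted 0 to-root from-root
      where
      d<n : suc m < n
      d<n = <h⇒<n 1+m<h
      1+m<m+h : suc m < m + h
      1+m<m+h = <-≤-trans 1+m<h (m≤n+m h m)

      to-root : ∀ a → a < n → Path O (_≢ cyc (suc m)) a 0
      to-root a a<n with region a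
      ... | origin = path stop
      ... | lower 1≤a a≤m = lower-to-0 d<n 1≤a a≤m (inj₂ (n≤1+n m)) 1+m<m+h
      ... | centre = cyc-arc⁻ m d<n twisted-m (cyc-≢ (<h⇒<n m<h) d<n (<⇒≢ (n<1+n m)))
                     ⊙ via-upper-to-0 d<n m m<h m-even 1+m<m+h
      ... | upper h≤a = upper-to-0 d<n (<-≤-trans m<h h≤a) a<n h≤a

      from-root : ∀ b → b < n → Path O (_≢ cyc (suc m)) 0 b
      from-root b b<n with region b
      ... | origin = path stop
      ... | lower 1≤b b≤m = 0-to-lower d<n (>⇒≢ ≤-refl) 1≤b b≤m (m≤n⇒m≤1+n b≤m)
      ... | centre = 0-to-upper d<n h≤last ≤-refl (inj₁ ≤-refl) ⊙ last-to-centre d<n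
      ... | upper h≤b = 0-to-upper d<n h≤b b<n (inj₁ ≤-refl)

    high-deletable : ∀ j → suc j < h → alternating true j ≡ false → Deletable M O (cyc (j + h))
    high-deletable j 1+j<h down = rooted 0 to-root from-root
      where
      d : ℕ
      d = j + h
      j<h : j < h
      j<h = <⇒≤ 1+j<h
      d<n : d < n
      d<n = <h⇒+h<n j<h
      j≢0 : j ≢ 0
      j≢0 j≡0 with trans (sym down) (cong (alternating true) j≡0)
      ... | ()
      j<m : j < m
      j<m with m≤n⇒m<n∨m≡n (s≤s⁻¹ (s≤s⁻¹ 1+j<h))
      ... | inj₁ j<m = j<m
      ... | inj₂ j≡m with trans (sym down) (trans (cong (alternating true) j≡m) m-even)
      ...   | ()
      m≤d : m ≤ d
      m≤d = ≤-trans (<⇒≤ m<h) (m≤n+m h j)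
      d<m+h : d < m + h
      d<m+h = +-monoˡ-< h j<m

      upper-to-root : ∀ a → h ≤ a → a < n → Path O (_≢ cyc d) a 0
      upper-to-root a h≤a a<n with a ≤? d
      ... | yes a≤d = upper-run d<n (<-≤-trans m<h h≤a) a≤d d<n (inj₂ ≤-refl)
                      ⊙ rung-arc⁻ j j<h down (λ ())
                      ⊙ lower-to-0 d<n (n≢0⇒n>0 j≢0) (<⇒≤ j<m) (inj₂ m≤d) d<m+h
      ... | no a≰d  = upper-to-0 d<n (<-≤-trans m<h h≤a) a<n (≰⇒> a≰d)

      to-root : ∀ a → a < n → Path O (_≢ cyc d) a 0
      to-root a a<n with region a
      ... | origin = path stop
      ... | lower 1≤a a≤m = lower-to-0 d<n 1≤a a≤m (inj₂ m≤d) d<m+h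
      ... | centre = cyc-arc (suc m) h<n (twisted-forward (λ ()) (>⇒≢ (n<1+n m)))
                            (cyc-≢ (<h⇒<n 1+m<h) d<n (<⇒≢ (<-≤-trans 1+m<h (m≤n+m h j))))
                     ⊙ upper-to-root h ≤-refl h<n
      ... | upper h≤a = upper-to-root a h≤a a<n

      h≢d : h ≢ d
      h≢d = <⇒≢ (+-monoˡ-< h (n≢0⇒n>0 j≢0))

      root-to-upper : ∀ b → h ≤ b → b < n → Path O (_≢ cyc d) 0 b
      root-to-upper b h≤b b<n with b ≤? d
      ... | yes b≤d = 0-to-upper d<n h≤b b<n (inj₂ b≤d)
      ... | no b≰d  = 0-to-lower d<n h≢d (s≤s z≤n) j<m (<-≤-trans j<m m≤d)
                      ⊙ rung-arc (suc j) 1+j<h (cong not down) (λ ())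
                      ⊙ upper-run d<n (<-≤-trans m<h (m≤n+m h (suc j))) (≰⇒> b≰d) b<n (inj₁ ≤-refl)

      from-root : ∀ b → b < n → Path O (_≢ cyc d) 0 b
      from-root b b<n with region b
      ... | origin = path stop
      ... | lower 1≤b b≤m = 0-to-lower d<n h≢d 1≤b b≤m (≤-trans b≤m m≤d)
      ... | centre = root-to-upper last h≤last ≤-refl ⊙ last-to-centre d<n
      ... | upper h≤b = root-to-upper b h≤b b<n

    last-deletable : Deletable M O (cyc last)
    last-deletable = rooted last to-root from-root
      where
      last<n : last < n
      last<n = ≤-refl

      to-root : ∀ a → a < n → Path O (_≢ cyc last) a last
      to-root a a<n with region a
      ... | origin = 0-to-h last<n ⊙ upper-run last<n m<h h≤last ≤-refl (inj₂ ≤-refl)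
      ... | lower 1≤a a≤m = low-run last<n 1≤a a≤m ≤-refl (inj₂ (<⇒≤ m<last))
                            ⊙ rung-arc m m<h m-even (λ ())
                            ⊙ upper-run last<n (m<m+n m z<s) (<n⇒≤last (<h⇒+h<n m<h)) ≤-refl (inj₂ ≤-refl)
      ... | centre = upper-run last<n (n<1+n m) (<n⇒≤last a<n) ≤-refl (inj₂ ≤-refl)
      ... | upper h≤a = upper-run last<n (<-≤-trans m<h h≤a) (<n⇒≤last a<n) ≤-refl (inj₂ ≤-refl)

      last-to-h : Path O (_≢ cyc last) last h
      last-to-h = last-to-centre last<n
                  ⊙ cyc-arc (suc m) h<n (twisted-forward (λ ()) (>⇒≢ (n<1+n m)))
                           (cyc-≢ (<h⇒<n 1+m<h) last<n (<⇒≢ 1+m<last))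

      last-to-1 : Path O (_≢ cyc last) last 1
      last-to-1 = last-to-h ⊙ h-to-1 last<n (<⇒≢ (<-≤-trans (n<1+n h) (<n⇒≤last (<h⇒+h<n 1<h))))

      from-root : ∀ b → b < n → Path O (_≢ cyc last) last b
      from-root b b<n with region b
      ... | origin = last-to-1 ⊙ cyc-arc⁻ 0 (<h⇒<n 1<h) refl (cyc-≢ z<s last<n (λ ()))
      ... | lower 1≤b b≤m = last-to-1 ⊙ low-run last<n ≤-refl 1≤b b≤m (inj₂ (<n⇒≤last b<n))
      ... | centre = last-to-centre last<n
      ... | upper h≤b = last-to-h ⊙ upper-run last<n m<h h≤b b<n (inj₂ (<n⇒≤last b<n))

  module EvenHalf (m-even : alternating true m ≡ true) where
    module B = CycleForward (alternating false)
    module T = Twisted m-even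

    cyc-deletable : ∀ d → d < n → Deletable M B.O (cyc d) ⊎ Deletable M T.O (cyc d)
    cyc-deletable d d<n with cyc-position d d<n
    ... | low 1+d<h with alternating true d in eq
    ...   | false = inj₁ (B.low-deletable d 1+d<h (alternating-flip d eq) (cong not (alternating-flip d eq)))
    ...   | true  = inj₂ (T.low-deletable d 1+d<h eq)
    cyc-deletable d d<n | middle refl = inj₂ T.middle-deletable
    cyc-deletable d d<n | high j 1+j<h refl with alternating true j in eq
    ...   | true  = inj₁ (B.high-deletable j 1+j<h (alternating-flip j eq) (cong not (alternating-flip j eq)))
    ...   | false = inj₂ (T.high-deletable j 1+j<h eq)
    cyc-deletable d d<n | wrap refl = inj₂ T.last-deletable

    cover : DeletionCover M 2
    cover = cover-by-two B.O T.O (cycles-suffice B.rung-deletable cyc-deletable)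

  deletion-cover : DeletionCover M 2
  deletion-cover with alternating true m in eq
  ... | true  = EvenHalf.cover eq
  ... | false = OddHalf.cover eq

  frank-number : FrankNumberIs M 2
  frank-number = frank-number≡2 (≡-dec Fin._≟_ Fin._≟_) (cyc 0) one-orientation-insufficient deletion-cover

even⇒⌊n/2⌋+⌊n/2⌋≡n : ∀ {n} → 2 ∣ n → ⌊ n /2⌋ + ⌊ n /2⌋ ≡ n
even⇒⌊n/2⌋+⌊n/2⌋≡n (divides q refl) = begin
  ⌊ q * 2 /2⌋ + ⌊ q * 2 /2⌋  ≡⟨ cong (λ t → ⌊ t /2⌋ + ⌊ t /2⌋) q*2≡q+q ⟩
  ⌊ q + q /2⌋ + ⌊ q + q /2⌋  ≡⟨ cong (λ t → t + t) (n≡⌊n+n/2⌋ q) ⟨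
  q + q                      ≡⟨ q*2≡q+q ⟨
  q * 2                      ∎
  where
  open ≡-Reasoning
  q*2≡q+q : q * 2 ≡ q + q
  q*2≡q+q = trans (*-comm q 2) (cong (q +_) (+-identityʳ q))

lemma2p6 : ∀ (n : ℕ) → 4 ≤ n → 2 ∣ n → FrankNumberIs (Mobius n) 2
lemma2p6 (suc (suc (suc (suc k)))) (s≤s (s≤s (s≤s (s≤s z≤n)))) 2∣n =
  Ladder.frank-number k (even⇒⌊n/2⌋+⌊n/2⌋≡n 2∣n)
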